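{- For every integer $k\ge 2$ and every integer $n\ge 2k$ there exists a digraph $D$ on $n$ vertices with $\delta(D)=\lceil (n+k)/2\rceil-2$ which is not $k$-ordered.
   Context: Digraphs are finite, without loops, with at most one edge in each direction between any two vertices. The minimum degree of a digraph $D$ is $\delta(D):=\min\{\delta^+(D),\delta^-(D)\}$, where $\delta^+(D)$ and $\delta^-(D)$ are the minimum outdegree and minimum indegree of $D$. A digraph $D$ is $k$-ordered if $|D|\ge k$ and for every sequence $s_1,\dots,s_k$ of distinct vertices of $D$ there is a directed cycle in $D$ which encounters $s_1,\dots,s_k$ in this order. -}

module Defs where

open import Data.Nat using (ℕ; zero; suc; _<_; _≤_; _≥_)
open import Data.Fin using (Fin)
open import Data.Bool using (Bool; true; false; T)
open import Data.List using (List; length; filterᵇ; allFin; lookup)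
open import Data.List.Relation.Unary.Unique.Propositional using (Unique)
open import Data.Product using (Σ; _×_; ∃-syntax)
open import Data.Sum using (_⊎_)
open import Relation.Binary.PropositionalEquality using (_≡_)
open import Relation.Nullary using (¬_)
open import Data.Empty using (⊥)

-- A Boolean relation
-- automatically has at most one edge in each direction between two
-- vertices; we require looplessness.
record Digraph (n : ℕ) : Set where
  field
    adj    : Fin n → Fin n → Bool
    loopless : ∀ v → adj v v ≡ false
open Digraph public

outdeg : ∀ {n} → Digraph n → Fin n → ℕ
outdeg D v = length (filterᵇ (λ w → adj D v w) (allFin _))

indeg : ∀ {n} → Digraph n → Fin n → ℕ
indeg D v = length (filterᵇ (λ u → adj D u v) (allFin _))

-- δ(D) = min(δ⁺(D), δ⁻(D)) = m, i.e. every in/out-degree is ≥ m and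
-- some in- or out-degree equals m.
MinDegreeIs : ∀ {n} → Digraph n → ℕ → Set
MinDegreeIs {n} D m =
  (∀ v → m ≤ outdeg D v × m ≤ indeg D v) ×
  (∃[ v ] (outdeg D v ≡ m ⊎ indeg D v ≡ m))

record Cycle {n : ℕ} (D : Digraph n) : Set where
  field
    verts    : List (Fin n)
    long     : 2 ≤ length verts
    distinct : Unique verts
    step     : (i j : Fin (length verts)) →
               suc (Data.Fin.toℕ i) ≡ Data.Fin.toℕ j →
               T (adj D (lookup verts i) (lookup verts j))
    close    : (i j : Fin (length verts)) →
               suc (Data.Fin.toℕ i) ≡ length verts → Data.Fin.toℕ j ≡ 0 →
               T (adj D (lookup verts i) (lookup verts j))
open Cycle public

-- The cycle C encounters s₁,…,s_k in this order: listing the cycle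
-- starting at a suitable vertex, the s_j occur at strictly increasing
-- positions.  (Rotations of the cycle are again cycles, so fixing the
-- listing start is no loss.)
Encounters : ∀ {n k} {D : Digraph n} → Cycle D → (Fin k → Fin n) → Set
Encounters {k = k} C s =
  Σ (Fin k → Fin (length (verts C))) λ pos →
    (∀ j → lookup (verts C) (pos j) ≡ s j) ×
    (∀ i j → Data.Fin._<_ i j → Data.Fin._<_ (pos i) (pos j))

KOrdered : ∀ {n} → ℕ → Digraph n → Set
KOrdered {n} k D =
  k ≤ n ×
  ((s : Fin k → Fin n) → (∀ i j → s i ≡ s j → i ≡ j) →
    Σ (Cycle D) λ C → Encounters C s)

-- Write k = k′ + 2 and cut the vertices 0, …, n − 1 into consecutive blocks Z = {0},
-- F = {1, …, k′}, B (b = ⌈(n − k)/2⌉ vertices), S (one vertex) and A (the remaining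
-- a′ = ⌊(n − k)/2⌋).  All arcs are present except those from B to A, from S ∪ A to B,
-- and from B to Z (from B to S instead when k′ = 0).  Every vertex misses at most a′ + 1
-- in- or out-neighbours, a vertex of B exactly that many, so δ = n − 2 − a′ = ⌈(n + k)/2⌉ − 2.
-- Prescribe the order S, b₀, 0, 1, …, k′ − 1.  Between S and b₀ a cycle must leave S ∪ A,
-- which it can only do into Z ∪ F; between b₀ and the next prescribed vertex (0, or S when
-- k′ = 0) it must leave B, which it can only do into F ∪ {S} (into Z when k′ = 0).  Each
-- such landing vertex other than the hub k′ is prescribed at a position the cycle has not
-- reached or has already passed, so the cycle would have to visit the hub k′ twice.

module Submission where

open import Data.Bool using (Bool; true; false; T; not; _∧_)
open import Data.Bool.Properties using (T-∧)
open import Data.Empty using (⊥; ⊥-elim)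
open import Data.Fin using (Fin; toℕ; fromℕ<)
import Data.Fin as Fin
open import Data.Fin.Properties using (toℕ-injective; toℕ-fromℕ<; toℕ<n)
open import Data.List using (List; []; _∷_; length; filterᵇ; tabulate; lookup; map)
open import Data.List.Membership.Propositional.Properties using (∈-lookup)
import Data.List.Relation.Unary.All as All
open import Data.List.Relation.Unary.AllPairs using (_∷_)
open import Data.List.Relation.Unary.Unique.Propositional using (Unique)
open import Data.Nat
  using ( ℕ; zero; suc; _+_; _*_; _∸_; _≤_; _<_; _≤?_; _≟_; _≡ᵇ_; ⌈_/2⌉; ⌊_/2⌋
        ; z≤n; s≤s; z<s; s<s; NonZero; >-nonZero)
open import Data.Nat.DivMod
  using (_%_; _/_; _mod_; m≡m%n+[m/n]*n; [m+kn]%n≡m%n; [m+n]%n≡m%n; m<n⇒m%n≡m; m%n<n; n%n≡0)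
open import Data.Nat.ListAction using (sum)
open import Data.Nat.Properties
open import Data.Product using (Σ; _×_; _,_; proj₂; ∃-syntax)
open import Data.Sum using (_⊎_; inj₁; inj₂)
open import Data.Unit using (tt)
open import Function using (_∘_; id)
open import Function.Bundles using (Equivalence)
open import Relation.Binary using (tri<; tri≈; tri>)
open import Relation.Binary.PropositionalEquality
open import Relation.Nullary using (¬_; yes; no)
open import Relation.Nullary.Decidable using (T?)

open import Defs

≡ᵇ-refl : ∀ m → (m ≡ᵇ m) ≡ true
≡ᵇ-refl zero    = refl
≡ᵇ-refl (suc m) = ≡ᵇ-refl m

≡ᵇ-sym : ∀ m n → (m ≡ᵇ n) ≡ (n ≡ᵇ m)
≡ᵇ-sym zero    zero    = refl
≡ᵇ-sym zero    (suc n) = refl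
≡ᵇ-sym (suc m) zero    = refl
≡ᵇ-sym (suc m) (suc n) = ≡ᵇ-sym m n

⌈n/2⌉≤1+⌊n/2⌋ : ∀ n → ⌈ n /2⌉ ≤ suc ⌊ n /2⌋
⌈n/2⌉≤1+⌊n/2⌋ zero          = z≤n
⌈n/2⌉≤1+⌊n/2⌋ (suc zero)    = s≤s z≤n
⌈n/2⌉≤1+⌊n/2⌋ (suc (suc n)) = s≤s (⌈n/2⌉≤1+⌊n/2⌋ n)

⌈m+n+n/2⌉≡⌈m/2⌉+n : ∀ m n → ⌈ m + n + n /2⌉ ≡ ⌈ m /2⌉ + n
⌈m+n+n/2⌉≡⌈m/2⌉+n m zero =
  trans (cong ⌈_/2⌉ (trans (+-identityʳ (m + 0)) (+-identityʳ m))) (sym (+-identityʳ ⌈ m /2⌉))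
⌈m+n+n/2⌉≡⌈m/2⌉+n m (suc n) = begin
  ⌈ m + suc n + suc n /2⌉     ≡⟨ cong ⌈_/2⌉ (trans (+-suc (m + suc n) n) (cong (λ x → suc (x + n)) (+-suc m n))) ⟩
  ⌈ suc (suc (m + n + n)) /2⌉ ≡⟨ cong suc (⌈m+n+n/2⌉≡⌈m/2⌉+n m n) ⟩
  suc (⌈ m /2⌉ + n)           ≡⟨ +-suc ⌈ m /2⌉ n ⟨
  ⌈ m /2⌉ + suc n             ∎
  where open ≡-Reasoning

_·_ : Bool → ℕ → ℕ
true  · n = n
false · n = 0

count : (ℕ → Bool) → ℕ → ℕ
count p zero    = 0
count p (suc n) = p 0 · 1 + count (p ∘ suc) n

count-cong : ∀ {p q} n → (∀ i → i < n → p i ≡ q i) → count p n ≡ count q n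
count-cong zero    _  = refl
count-cong (suc n) eq =
  cong₂ (λ x y → x · 1 + y) (eq 0 z<s) (count-cong n (λ i i<n → eq (suc i) (s<s i<n)))

count-const : ∀ {p} c n → (∀ i → i < n → p i ≡ c) → count p n ≡ c · n
count-const false zero    _  = refl
count-const true  zero    _  = refl
count-const false (suc n) eq rewrite eq 0 z<s = count-const false n (λ i i<n → eq (suc i) (s<s i<n))
count-const true  (suc n) eq rewrite eq 0 z<s = cong suc (count-const true n (λ i i<n → eq (suc i) (s<s i<n)))

count-+ : ∀ p m n → count p (m + n) ≡ count p m + count (λ i → p (m + i)) n
count-+ p zero    n = refl
count-+ p (suc m) n = trans (cong (p 0 · 1 +_) (count-+ (p ∘ suc) m n)) (sym (+-assoc (p 0 · 1) _ _))

count-remove : ∀ q {v} n → v < n → q v ≡ true →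
               suc (count (λ w → not (w ≡ᵇ v) ∧ q w) n) ≡ count q n
count-remove q {zero}  (suc n) _         qv rewrite qv = refl
count-remove q {suc v} (suc n) (s<s v<n) qv =
  trans (sym (+-suc (q 0 · 1) _)) (cong (q 0 · 1 +_) (count-remove (q ∘ suc) n v<n qv))

length-filterᵇ-∷ : ∀ {A : Set} (q : A → Bool) x xs →
                   length (filterᵇ q (x ∷ xs)) ≡ q x · 1 + length (filterᵇ q xs)
length-filterᵇ-∷ q x xs with q x
... | true  = refl
... | false = refl

length-filterᵇ-tabulate : ∀ {A : Set} n (f : Fin n → A) (q : A → Bool) (h : ℕ → Bool) →
                          (∀ i → q (f i) ≡ h (toℕ i)) → length (filterᵇ q (tabulate f)) ≡ count h n
length-filterᵇ-tabulate zero    f q h eq = refl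
length-filterᵇ-tabulate (suc n) f q h eq =
  trans (length-filterᵇ-∷ q (f Fin.zero) (tabulate (f ∘ Fin.suc)))
        (cong₂ (λ b c → b · 1 + c) (eq Fin.zero)
               (length-filterᵇ-tabulate n (f ∘ Fin.suc) q (h ∘ suc) (eq ∘ Fin.suc)))

module _ {P : Set} where

  blockOf : List (P × ℕ) → P → ℕ → P
  blockOf []                 d v       = d
  blockOf ((c , zero)  ∷ bs) d v       = blockOf bs d v
  blockOf ((c , suc s) ∷ bs) d zero    = c
  blockOf ((c , suc s) ∷ bs) d (suc v) = blockOf ((c , s) ∷ bs) d v

  size : List (P × ℕ) → ℕ
  size = sum ∘ map proj₂

  weight : (P → Bool) → List (P × ℕ) → ℕ
  weight g = sum ∘ map (λ (c , s) → g c · s)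

  blockOf-head : ∀ c s bs d {v} → v < s → blockOf ((c , s) ∷ bs) d v ≡ c
  blockOf-head c (suc s) bs d {zero}  _         = refl
  blockOf-head c (suc s) bs d {suc v} (s<s v<s) = blockOf-head c s bs d v<s

  blockOf-tail : ∀ c s bs d v → blockOf ((c , s) ∷ bs) d (s + v) ≡ blockOf bs d v
  blockOf-tail c zero    bs d v = refl
  blockOf-tail c (suc s) bs d v = blockOf-tail c s bs d v

  count-blockOf : ∀ g bs d m → count (g ∘ blockOf bs d) (size bs + m) ≡ weight g bs + g d · m
  count-blockOf g []             d m = count-const (g d) m (λ _ _ → refl)
  count-blockOf g ((c , s) ∷ bs) d m = begin
    count (g ∘ blockOf ((c , s) ∷ bs) d) ((s + size bs) + m)
      ≡⟨ cong (count _) (+-assoc s (size bs) m) ⟩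
    count (g ∘ blockOf ((c , s) ∷ bs) d) (s + (size bs + m))
      ≡⟨ count-+ _ s _ ⟩
    count (g ∘ blockOf ((c , s) ∷ bs) d) s + count (λ i → g (blockOf ((c , s) ∷ bs) d (s + i))) (size bs + m)
      ≡⟨ cong₂ _+_ (count-const (g c) s (λ i i<s → cong g (blockOf-head c s bs d i<s)))
                   (count-cong (size bs + m) (λ i _ → cong g (blockOf-tail c s bs d i))) ⟩
    g c · s + count (g ∘ blockOf bs d) (size bs + m)
      ≡⟨ cong (g c · s +_) (count-blockOf g bs d m) ⟩
    g c · s + (weight g bs + g d · m)
      ≡⟨ sym (+-assoc (g c · s) _ _) ⟩
    weight g ((c , s) ∷ bs) + g d · m ∎
    where open ≡-Reasoning

crossing : ∀ (P : ℕ → Bool) {a b} → a ≤ b → T (P a) → ¬ T (P b) →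
       ∃[ r ] a ≤ r × r < b × T (P r) × ¬ T (P (suc r))
crossing P {b = zero}  z≤n pa ¬pb = ⊥-elim (¬pb pa)
crossing P {a} {suc b} a≤b+1 pa ¬pb+1 with m≤n⇒m<n∨m≡n a≤b+1
... | inj₂ refl       = ⊥-elim (¬pb+1 pa)
... | inj₁ (s≤s a≤b) with T? (P b)
...   | yes pb = b , a≤b , ≤-refl , pb , ¬pb+1
...   | no ¬pb with crossing P a≤b pa ¬pb
...     | r , a≤r , r<b , pr , ¬pr+1 = r , a≤r , m<n⇒m<1+n r<b , pr , ¬pr+1

lookup-injective : ∀ {A : Set} {xs : List A} → Unique xs → ∀ {i j} → lookup xs i ≡ lookup xs j → i ≡ j
lookup-injective (_    ∷ _) {Fin.zero}  {Fin.zero}  _ = refl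
lookup-injective (x∉xs ∷ _) {Fin.zero}  {Fin.suc j} e = ⊥-elim (All.lookup x∉xs (∈-lookup j) e)
lookup-injective (x∉xs ∷ _) {Fin.suc i} {Fin.zero}  e = ⊥-elim (All.lookup x∉xs (∈-lookup i) (sym e))
lookup-injective (_    ∷ u) {Fin.suc i} {Fin.suc j} e = cong Fin.suc (lookup-injective u e)

%-injective-window : ∀ {i j L} .{{_ : NonZero L}} → i < j → j < i + L → i % L ≢ j % L
%-injective-window {i} {j} {L} i<j j<i+L i%L≡j%L =
  <⇒≱ (*-cancelʳ-< L (j / L) (suc (i / L)) qjL<[1+qi]L) (*-cancelʳ-< L (i / L) (j / L) qiL<qjL)
  where
  open ≤-Reasoning
  i≡ : i ≡ j % L + i / L * L
  i≡ = trans (m≡m%n+[m/n]*n i L) (cong (_+ i / L * L) i%L≡j%L)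
  qiL<qjL : i / L * L < j / L * L
  qiL<qjL = +-cancelˡ-< (j % L) _ _ (begin-strict
    j % L + i / L * L ≡⟨ sym i≡ ⟩
    i                 <⟨ i<j ⟩
    j                 ≡⟨ m≡m%n+[m/n]*n j L ⟩
    j % L + j / L * L ∎)
  qjL<[1+qi]L : j / L * L < suc (i / L) * L
  qjL<[1+qi]L = +-cancelˡ-< (j % L) _ _ (begin-strict
    j % L + j / L * L       ≡⟨ sym (m≡m%n+[m/n]*n j L) ⟩
    j                       <⟨ j<i+L ⟩
    i + L                   ≡⟨ cong (_+ L) i≡ ⟩
    j % L + i / L * L + L   ≡⟨ +-assoc (j % L) _ L ⟩
    j % L + (i / L * L + L) ≡⟨ cong (j % L +_) (+-comm (i / L * L) L) ⟩
    j % L + suc (i / L) * L ∎)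

module Walk {n} {D : Digraph n} (C : Cycle D) where

  L : ℕ
  L = length (verts C)

  instance
    L-nonZero : NonZero L
    L-nonZero = >-nonZero (≤-trans (s≤s z≤n) (long C))

  walk : ℕ → Fin n
  walk i = lookup (verts C) (i mod L)

  toℕ-mod : ∀ i → toℕ (i mod L) ≡ i % L
  toℕ-mod i = toℕ-fromℕ< (m%n<n i L)

  walk-toℕ : ∀ x → walk (toℕ x) ≡ lookup (verts C) x
  walk-toℕ x = cong (lookup (verts C)) (toℕ-injective (trans (toℕ-mod (toℕ x)) (m<n⇒m%n≡m (toℕ<n x))))

  walk-+L : ∀ i → walk (i + L) ≡ walk i
  walk-+L i = cong (lookup (verts C))
    (toℕ-injective (trans (toℕ-mod (i + L)) (trans ([m+n]%n≡m%n i L) (sym (toℕ-mod i)))))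

  suc-% : ∀ i → suc i % L ≡ suc (i % L) % L
  suc-% i = trans (cong (λ m → suc m % L) (m≡m%n+[m/n]*n i L)) ([m+kn]%n≡m%n (suc (i % L)) (i / L) L)

  walk-step : ∀ i → T (adj D (walk i) (walk (suc i)))
  walk-step i with m≤n⇒m<n∨m≡n (m%n<n i L)
  ... | inj₁ i%L+1<L = step C (i mod L) (suc i mod L) (begin
    suc (toℕ (i mod L)) ≡⟨ cong suc (toℕ-mod i) ⟩
    suc (i % L)         ≡⟨ sym (m<n⇒m%n≡m i%L+1<L) ⟩
    suc (i % L) % L     ≡⟨ sym (suc-% i) ⟩
    suc i % L           ≡⟨ sym (toℕ-mod (suc i)) ⟩
    toℕ (suc i mod L)   ∎)
    where open ≡-Reasoning
  ... | inj₂ i%L+1≡L = close C (i mod L) (suc i mod L) (trans (cong suc (toℕ-mod i)) i%L+1≡L) (begin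
    toℕ (suc i mod L) ≡⟨ toℕ-mod (suc i) ⟩
    suc i % L         ≡⟨ suc-% i ⟩
    suc (i % L) % L   ≡⟨ cong (_% L) i%L+1≡L ⟩
    L % L             ≡⟨ n%n≡0 L ⟩
    0                 ∎)
    where open ≡-Reasoning

  walk-≡⇒%-≡ : ∀ {i j} → walk i ≡ walk j → i % L ≡ j % L
  walk-≡⇒%-≡ {i} {j} eq =
    trans (sym (toℕ-mod i)) (trans (cong toℕ (lookup-injective (distinct C) eq)) (toℕ-mod j))

  walk-injective : ∀ {a i j} → a ≤ i → i < a + L → a ≤ j → j < a + L → walk i ≡ walk j → i ≡ j
  walk-injective {a} {i} {j} a≤i i<a+L a≤j j<a+L eq with <-cmp i j
  ... | tri≈ _ i≡j _ = i≡j
  ... | tri< i<j _ _ =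
    ⊥-elim (%-injective-window i<j (<-≤-trans j<a+L (+-monoˡ-≤ L a≤i)) (walk-≡⇒%-≡ eq))
  ... | tri> _ _ j<i =
    ⊥-elim (%-injective-window j<i (<-≤-trans i<a+L (+-monoˡ-≤ L a≤j)) (sym (walk-≡⇒%-≡ eq)))

data Part : Set where
  Z F B S A : Part

isZF isB isSA : Part → Bool
isZF Z = true
isZF F = true
isZF _ = false
isB B = true
isB _ = false
isSA S = true
isSA A = true
isSA _ = false

module Construction (k′ b : ℕ) where

  blocks : List (Part × ℕ)
  blocks = (Z , 1) ∷ (F , k′) ∷ (B , b) ∷ (S , 1) ∷ []

  part : ℕ → Part
  part = blockOf blocks A

  arc : Part → Part → Bool
  arc B Z = k′ ≡ᵇ 0
  arc B S = not (k′ ≡ᵇ 0)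
  arc B A = false
  arc S B = false
  arc A B = false
  arc _ _ = true

  arc-refl : ∀ c → arc c c ≡ true
  arc-refl Z = refl
  arc-refl F = refl
  arc-refl B = refl
  arc-refl S = refl
  arc-refl A = refl

  digraph : (n : ℕ) → Digraph n
  adj      (digraph n) u w = not (toℕ u ≡ᵇ toℕ w) ∧ arc (part (toℕ u)) (part (toℕ w))
  loopless (digraph n) v   = cong (λ e → not e ∧ arc (part (toℕ v)) (part (toℕ v))) (≡ᵇ-refl (toℕ v))

  bVertex sVertex : ℕ
  bVertex = suc k′
  sVertex = suc (k′ + b)

  part-F : ∀ {j} → j < k′ → part (suc j) ≡ F
  part-F j<k′ = blockOf-head F k′ _ A j<k′

  part-beyond-F : ∀ w → part (suc (k′ + w)) ≡ blockOf ((B , b) ∷ (S , 1) ∷ []) A w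
  part-beyond-F w = blockOf-tail F k′ _ A w

  part-beyond-B : ∀ w → part (suc (k′ + (b + w))) ≡ blockOf ((S , 1) ∷ []) A w
  part-beyond-B w = trans (part-beyond-F (b + w)) (blockOf-tail B b _ A w)

  part-bVertex : 1 ≤ b → part bVertex ≡ B
  part-bVertex 1≤b = begin
    part (suc k′)       ≡⟨ cong (λ m → part (suc m)) (sym (+-identityʳ k′)) ⟩
    part (suc (k′ + 0)) ≡⟨ part-beyond-F 0 ⟩
    blockOf ((B , b) ∷ (S , 1) ∷ []) A 0 ≡⟨ blockOf-head B b _ A 1≤b ⟩
    B                   ∎
    where open ≡-Reasoning

  part-sVertex : part sVertex ≡ S
  part-sVertex = trans (cong (λ m → part (suc (k′ + m))) (sym (+-identityʳ b))) (part-beyond-B 0)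

  ≤k′⇒isZF : ∀ {v} → v ≤ k′ → T (isZF (part v))
  ≤k′⇒isZF {zero}  _          = tt
  ≤k′⇒isZF {suc j} j<k′ rewrite part-F j<k′ = tt

  above-k′ : ∀ {v} → k′ < v → ∃[ w ] v ≡ suc (k′ + w)
  above-k′ {v} k′<v = v ∸ suc k′ , sym (m+[n∸m]≡n k′<v)

  isZF⇒≤k′ : ∀ {v} → T (isZF (part v)) → v ≤ k′
  isZF⇒≤k′ {v} zf with v ≤? k′
  ... | yes v≤k′ = v≤k′
  ... | no  v≰k′ with above-k′ (≰⇒> v≰k′)
  ...   | w , refl = ⊥-elim (¬ZF b w (subst (T ∘ isZF) (part-beyond-F w) zf))
    where
    ¬ZF : ∀ m w → ¬ T (isZF (blockOf ((B , m) ∷ (S , 1) ∷ []) A w))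
    ¬ZF zero    zero    ()
    ¬ZF zero    (suc w) ()
    ¬ZF (suc m) zero    ()
    ¬ZF (suc m) (suc w) = ¬ZF m w

  part≡S⇒sVertex : ∀ {v} → part v ≡ S → v ≡ sVertex
  part≡S⇒sVertex {v} eq with v ≤? k′
  ... | yes v≤k′ = ⊥-elim (subst (T ∘ isZF) eq (≤k′⇒isZF v≤k′))
  ... | no  v≰k′ with above-k′ (≰⇒> v≰k′)
  ...   | w , refl = cong (λ m → suc (k′ + m)) (at-S b w (trans (sym (part-beyond-F w)) eq))
    where
    at-S : ∀ m w → blockOf ((B , m) ∷ (S , 1) ∷ []) A w ≡ S → w ≡ m
    at-S zero    zero    _  = refl
    at-S zero    (suc w) ()
    at-S (suc m) zero    ()
    at-S (suc m) (suc w) eq = cong suc (at-S m w eq)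

  module Degrees {n a′ : ℕ} (n≡ : 2 + k′ + (b + a′) ≡ n) (b≤a′+1 : b ≤ suc a′) where

    size-blocks : size blocks + a′ ≡ n
    size-blocks = begin
      suc (k′ + (b + 1)) + a′ ≡⟨ cong (λ m → suc m + a′) (trans (cong (k′ +_) (+-comm b 1)) (+-suc k′ b)) ⟩
      2 + k′ + b + a′         ≡⟨ +-assoc (2 + k′) b a′ ⟩
      2 + k′ + (b + a′)       ≡⟨ n≡ ⟩
      n                       ∎
      where open ≡-Reasoning

    total-weight : (Part → Bool) → ℕ
    total-weight g = weight g blocks + g A · a′

    count-except : ∀ g {v} → v < n → g (part v) ≡ true →
                   suc (count (λ w → not (w ≡ᵇ v) ∧ g (part w)) n) ≡ total-weight g
    count-except g v<n gv = begin
      suc (count (λ w → not (w ≡ᵇ _) ∧ g (part w)) n) ≡⟨ count-remove (g ∘ part) n v<n gv ⟩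
      count (g ∘ part) n                              ≡⟨ cong (count (g ∘ part)) size-blocks ⟨
      count (g ∘ part) (size blocks + a′)             ≡⟨ count-blockOf g blocks A a′ ⟩
      total-weight g                                  ∎
      where open ≡-Reasoning

    suc-outdeg : ∀ v → suc (outdeg (digraph n) v) ≡ total-weight (arc (part (toℕ v)))
    suc-outdeg v = trans (cong suc (length-filterᵇ-tabulate n id _ _ adj≡))
                         (count-except (arc (part (toℕ v))) (toℕ<n v) (arc-refl (part (toℕ v))))
      where
      adj≡ : ∀ w → adj (digraph n) v w ≡ not (toℕ w ≡ᵇ toℕ v) ∧ arc (part (toℕ v)) (part (toℕ w))
      adj≡ w = cong (λ e → not e ∧ arc (part (toℕ v)) (part (toℕ w))) (≡ᵇ-sym (toℕ v) (toℕ w))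

    suc-indeg : ∀ v → suc (indeg (digraph n) v) ≡ total-weight (λ c → arc c (part (toℕ v)))
    suc-indeg v = trans (cong suc (length-filterᵇ-tabulate n id _ _ (λ _ → refl)))
                        (count-except (λ c → arc c (part (toℕ v))) (toℕ<n v) (arc-refl (part (toℕ v))))

    total-weight-≥ : ∀ g → g Z ≡ true → g F ≡ true → g S ≡ true → g A ≡ true →
                     suc (b + k′) ≤ total-weight g
    total-weight-≥ g gZ gF gS gA rewrite gZ | gF | gS | gA = begin
      suc (b + k′)                        ≤⟨ s≤s (+-monoˡ-≤ k′ b≤a′+1) ⟩
      suc (suc a′ + k′)                   ≡⟨ cong suc (+-comm (suc a′) k′) ⟩
      suc (k′ + suc a′)                   ≡⟨ cong suc (+-assoc k′ 1 a′) ⟨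
      1 + (k′ + (0 + (1 + 0))) + a′       ≤⟨ +-monoˡ-≤ a′ (s≤s (+-monoʳ-≤ k′ (+-monoˡ-≤ (1 + 0) z≤n))) ⟩
      1 + (k′ + (g B · b + (1 + 0))) + a′ ∎
      where open ≤-Reasoning

    total-weight-in-B : total-weight (λ c → arc c B) ≡ suc (b + k′)
    total-weight-in-B = cong suc (trans (+-identityʳ _) (trans (cong (k′ +_) (+-identityʳ b)) (+-comm k′ b)))

    total-weight-out-B : total-weight (arc B) ≡ suc (b + k′)
    total-weight-out-B with k′ ≡ᵇ 0
    ... | true  = total-weight-in-B
    ... | false = trans (+-identityʳ _) (trans (cong (k′ +_) (+-comm b 1)) (trans (+-suc k′ b) (cong suc (+-comm k′ b))))

    out-weight-≥ : ∀ c → suc (b + k′) ≤ total-weight (arc c)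
    out-weight-≥ Z = total-weight-≥ (arc Z) refl refl refl refl
    out-weight-≥ F = total-weight-≥ (arc F) refl refl refl refl
    out-weight-≥ B = ≤-reflexive (sym total-weight-out-B)
    out-weight-≥ S = total-weight-≥ (arc S) refl refl refl refl
    out-weight-≥ A = total-weight-≥ (arc A) refl refl refl refl

    in-weight-≥ : ∀ c → suc (b + k′) ≤ total-weight (λ d → arc d c)
    in-weight-≥ Z = total-weight-≥ (λ d → arc d Z) refl refl refl refl
    in-weight-≥ F = total-weight-≥ (λ d → arc d F) refl refl refl refl
    in-weight-≥ B = ≤-reflexive (sym total-weight-in-B)
    in-weight-≥ S = total-weight-≥ (λ d → arc d S) refl refl refl refl
    in-weight-≥ A = total-weight-≥ (λ d → arc d A) refl refl refl refl

    minimum-degree : 1 ≤ b → MinDegreeIs (digraph n) (b + k′)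
    minimum-degree 1≤b =
      (λ v → ≤-pred (subst (suc (b + k′) ≤_) (sym (suc-outdeg v)) (out-weight-≥ (part (toℕ v))))
           , ≤-pred (subst (suc (b + k′) ≤_) (sym (suc-indeg v)) (in-weight-≥ (part (toℕ v)))))
      , (v₀ , inj₁ (suc-injective (begin
          suc (outdeg (digraph n) v₀)       ≡⟨ suc-outdeg v₀ ⟩
          total-weight (arc (part (toℕ v₀))) ≡⟨ cong (total-weight ∘ arc) part-v₀ ⟩
          total-weight (arc B)              ≡⟨ total-weight-out-B ⟩
          suc (b + k′)                      ∎)))
      where
      open ≡-Reasoning
      bVertex<n : bVertex < n
      bVertex<n = subst (bVertex <_) size-blocks (s≤s (≤-trans (m<m+n k′ (m≤n+m 1 b)) (m≤m+n _ a′)))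
      v₀ : Fin n
      v₀ = fromℕ< bVertex<n
      part-v₀ : part (toℕ v₀) ≡ B
      part-v₀ = trans (cong part (toℕ-fromℕ< bVertex<n)) (part-bVertex 1≤b)

  arc-leaving-SA : ∀ c d → T (isSA c) → ¬ T (isSA d) → T (arc c d) → T (isZF d)
  arc-leaving-SA _ Z _  _   _  = tt
  arc-leaving-SA _ F _  _   _  = tt
  arc-leaving-SA _ S _  ¬sa _  = ⊥-elim (¬sa tt)
  arc-leaving-SA _ A _  ¬sa _  = ⊥-elim (¬sa tt)
  arc-leaving-SA S B _  _   ()
  arc-leaving-SA A B _  _   ()
  arc-leaving-SA Z B () _   _
  arc-leaving-SA F B () _   _
  arc-leaving-SA B B () _   _

  arc-leaving-B : ∀ c d → T (isB c) → ¬ T (isB d) → T (arc c d) →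
                  d ≡ F ⊎ (d ≡ S × k′ ≢ 0) ⊎ (d ≡ Z × k′ ≡ 0)
  arc-leaving-B B Z _  _  a = inj₂ (inj₂ (refl , ≡ᵇ⇒≡ k′ 0 a))
  arc-leaving-B B F _  _  _ = inj₁ refl
  arc-leaving-B B S _  _  a = inj₂ (inj₁ (refl , λ k′≡0 → subst (λ m → T (not (m ≡ᵇ 0))) k′≡0 a))
  arc-leaving-B B B _  ¬b _ = ⊥-elim (¬b tt)
  arc-leaving-B B A _  _  ()
  arc-leaving-B Z _ () _  _
  arc-leaving-B F _ () _  _
  arc-leaving-B S _ () _  _
  arc-leaving-B A _ () _  _

  leaving-SA : ∀ {u v} → T (isSA (part u)) → ¬ T (isSA (part v)) → T (arc (part u) (part v)) → v ≤ k′
  leaving-SA sa ¬sa a = isZF⇒≤k′ (arc-leaving-SA _ _ sa ¬sa a)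

  leaving-B : ∀ {u v} → T (isB (part u)) → ¬ T (isB (part v)) → T (arc (part u) (part v)) →
              v ≡ k′ ⊎ (1 ≤ v × v < k′) ⊎ (v ≡ sVertex × k′ ≢ 0)
  leaving-B {v = v} b ¬b a with arc-leaving-B _ (part v) b ¬b a
  ... | inj₂ (inj₁ (part≡S , k′≢0)) = inj₂ (inj₂ (part≡S⇒sVertex part≡S , k′≢0))
  ... | inj₂ (inj₂ (part≡Z , k′≡0)) =
    inj₁ (trans (n≤0⇒n≡0 (subst (v ≤_) k′≡0 (isZF⇒≤k′ (subst (T ∘ isZF) (sym part≡Z) tt)))) (sym k′≡0))
  ... | inj₁ part≡F with m≤n⇒m<n∨m≡n (isZF⇒≤k′ (subst (T ∘ isZF) (sym part≡F) tt))
  ...   | inj₂ v≡k′ = inj₁ v≡k′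
  ...   | inj₁ v<k′ = inj₂ (inj₁ (1≤v v part≡F , v<k′))
    where
    1≤v : ∀ v → part v ≡ F → 1 ≤ v
    1≤v (suc _) _ = s≤s z≤n

  module NotOrdered {n : ℕ} (1≤b : 1 ≤ b) (sVertex<n : sVertex < n) where

    k′<n : k′ < n
    k′<n = <-trans (n<1+n k′) (≤-<-trans (s≤s (m≤m+n k′ b)) sVertex<n)

    seqℕ : Fin (2 + k′) → ℕ
    seqℕ Fin.zero                = sVertex
    seqℕ (Fin.suc Fin.zero)      = bVertex
    seqℕ (Fin.suc (Fin.suc j))   = toℕ j

    seqℕ<n : ∀ j → seqℕ j < n
    seqℕ<n Fin.zero              = sVertex<n
    seqℕ<n (Fin.suc Fin.zero)    = ≤-<-trans (s≤s (m≤m+n k′ b)) sVertex<n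
    seqℕ<n (Fin.suc (Fin.suc j)) = <-trans (toℕ<n j) k′<n

    sequence : Fin (2 + k′) → Fin n
    sequence j = fromℕ< (seqℕ<n j)

    toℕ-sequence : ∀ j → toℕ (sequence j) ≡ seqℕ j
    toℕ-sequence j = toℕ-fromℕ< (seqℕ<n j)

    rank : Part → ℕ → ℕ
    rank S _ = 0
    rank B _ = 1
    rank _ v = 2 + v

    rank-seqℕ : ∀ j → rank (part (seqℕ j)) (seqℕ j) ≡ toℕ j
    rank-seqℕ Fin.zero              rewrite part-sVertex     = refl
    rank-seqℕ (Fin.suc Fin.zero)    rewrite part-bVertex 1≤b = refl
    rank-seqℕ (Fin.suc (Fin.suc j)) = rank-ZF (part (toℕ j)) (≤k′⇒isZF (<⇒≤ (toℕ<n j)))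
      where
      rank-ZF : ∀ c → T (isZF c) → rank c (toℕ j) ≡ 2 + toℕ j
      rank-ZF Z _ = refl
      rank-ZF F _ = refl

    sequence-injective : ∀ i j → sequence i ≡ sequence j → i ≡ j
    sequence-injective i j eq = toℕ-injective (begin
      toℕ i                           ≡⟨ rank-seqℕ i ⟨
      rank (part (seqℕ i)) (seqℕ i)   ≡⟨ cong (λ v → rank (part v) v) seqℕ-eq ⟩
      rank (part (seqℕ j)) (seqℕ j)   ≡⟨ rank-seqℕ j ⟩
      toℕ j                           ∎)
      where
      open ≡-Reasoning
      seqℕ-eq : seqℕ i ≡ seqℕ j
      seqℕ-eq = trans (sym (toℕ-sequence i)) (trans (cong toℕ eq) (toℕ-sequence j))

    seqℕ-F : ∀ {v} (v<k′ : v < k′) → seqℕ (Fin.suc (Fin.suc (fromℕ< v<k′))) ≡ v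
    seqℕ-F v<k′ = toℕ-fromℕ< v<k′

    module _ (C : Cycle (digraph n)) (pos : Fin (2 + k′) → Fin (length (verts C)))
             (hits : ∀ j → lookup (verts C) (pos j) ≡ sequence j)
             (mono : ∀ i j → i Fin.< j → pos i Fin.< pos j) where

      open Walk C

      p : Fin (2 + k′) → ℕ
      p j = toℕ (pos j)

      j₀ j₁ : Fin (2 + k′)
      j₀ = Fin.zero
      j₁ = Fin.suc Fin.zero

      walk-p : ∀ j → toℕ (walk (p j)) ≡ seqℕ j
      walk-p j = trans (cong toℕ (trans (walk-toℕ (pos j)) (hits j))) (toℕ-sequence j)

      p<L : ∀ j → p j < L
      p<L j = toℕ<n (pos j)

      p₀<p₁ : p j₀ < p j₁
      p₀<p₁ = mono j₀ j₁ z<s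

      p₀≤p : ∀ j → p j₀ ≤ p j
      p₀≤p Fin.zero    = ≤-refl
      p₀≤p (Fin.suc j) = <⇒≤ (mono j₀ (Fin.suc j) z<s)

      p<p₀+L : ∀ j → p j < p j₀ + L
      p<p₀+L j = <-≤-trans (p<L j) (m≤n+m L (p j₀))

      visits-once : ∀ {r} j → p j₀ ≤ r → r < p j₀ + L → toℕ (walk r) ≡ seqℕ j → r ≡ p j
      visits-once j p₀≤r r<p₀+L eq =
        walk-injective p₀≤r r<p₀+L (p₀≤p j) (p<p₀+L j) (toℕ-injective (trans eq (sym (walk-p j))))

      arc-along : ∀ r → T (arc (part (toℕ (walk r))) (part (toℕ (walk (suc r)))))
      arc-along r = proj₂ (Equivalence.to T-∧ (walk-step r))

      hub-before-b₀ : ∃[ r ] p j₀ < r × r ≤ p j₁ × toℕ (walk r) ≡ k′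
      hub-before-b₀ with crossing (isSA ∘ part ∘ toℕ ∘ walk) (<⇒≤ p₀<p₁) SA-at-p₀ ¬SA-at-p₁
        where
        SA-at-p₀ : T (isSA (part (toℕ (walk (p j₀)))))
        SA-at-p₀ = subst (T ∘ isSA) (sym (trans (cong part (walk-p j₀)) part-sVertex)) tt
        ¬SA-at-p₁ : ¬ T (isSA (part (toℕ (walk (p j₁)))))
        ¬SA-at-p₁ = subst (¬_ ∘ T ∘ isSA) (sym (trans (cong part (walk-p j₁)) (part-bVertex 1≤b))) (λ ())
      ... | r , p₀≤r , r<p₁ , sa , ¬sa with m≤n⇒m<n∨m≡n (leaving-SA {toℕ (walk r)} sa ¬sa (arc-along r))
      ...   | inj₂ v≡k′ = suc r , s≤s p₀≤r , r<p₁ , v≡k′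
      ...   | inj₁ v<k′ = ⊥-elim (<-irrefl r+1≡pj (≤-<-trans r<p₁ (mono j₁ j (s<s z<s))))
        where
        j : Fin (2 + k′)
        j = Fin.suc (Fin.suc (fromℕ< v<k′))
        r+1≡pj : suc r ≡ p j
        r+1≡pj = visits-once j (m≤n⇒m≤1+n p₀≤r) (≤-<-trans r<p₁ (p<p₀+L j₁)) (sym (seqℕ-F v<k′))

      hub-between-b₀-and : ∀ q → p j₁ ≤ q → ¬ T (isB (part (toℕ (walk q)))) →
                           (∀ j → 3 ≤ toℕ j → q < p j) → (k′ ≢ 0 → q < p j₀ + L) →
                           ∃[ r ] p j₁ < r × r ≤ q × toℕ (walk r) ≡ k′
      hub-between-b₀-and q p₁≤q ¬B-at-q q<p q<p₀+L with crossing (isB ∘ part ∘ toℕ ∘ walk) p₁≤q B-at-p₁ ¬B-at-q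
        where
        B-at-p₁ : T (isB (part (toℕ (walk (p j₁)))))
        B-at-p₁ = subst (T ∘ isB) (sym (trans (cong part (walk-p j₁)) (part-bVertex 1≤b))) tt
      ... | r , p₁≤r , r<q , b , ¬b with leaving-B {toℕ (walk r)} b ¬b (arc-along r)
      ...   | inj₁ v≡k′ = suc r , s≤s p₁≤r , r<q , v≡k′
      ...   | inj₂ (inj₁ (1≤v , v<k′)) = ⊥-elim (<-irrefl r+1≡pj r+1<pj)
        where
        j : Fin (2 + k′)
        j = Fin.suc (Fin.suc (fromℕ< v<k′))
        r+1<pj : suc r < p j
        r+1<pj = ≤-<-trans r<q (q<p j (s≤s (s≤s (subst (1 ≤_) (sym (toℕ-fromℕ< v<k′)) 1≤v))))
        r+1≡pj : suc r ≡ p j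
        r+1≡pj = visits-once j (≤-trans (<⇒≤ p₀<p₁) (m≤n⇒m≤1+n p₁≤r)) (<-trans r+1<pj (p<p₀+L j))
                   (sym (seqℕ-F v<k′))
      ...   | inj₂ (inj₂ (v≡sVertex , k′≢0)) =
        ⊥-elim (<-irrefl (sym r+1≡p₀) (<-≤-trans p₀<p₁ (m≤n⇒m≤1+n p₁≤r)))
        where
        r+1≡p₀ : suc r ≡ p j₀
        r+1≡p₀ = visits-once j₀ (≤-trans (<⇒≤ p₀<p₁) (m≤n⇒m≤1+n p₁≤r))
                   (≤-<-trans r<q (q<p₀+L k′≢0)) v≡sVertex

      hub-after-b₀ : ∃[ r ] p j₁ < r × r ≤ p j₀ + L × toℕ (walk r) ≡ k′
      hub-after-b₀ with k′ ≟ 0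
      ... | yes k′≡0 = hub-between-b₀-and (p j₀ + L) (<⇒≤ (p<p₀+L j₁)) ¬B-at-end
                         (λ j 3≤j → ⊥-elim (≤⇒≯ 3≤j
                           (≤-trans (subst (λ m → toℕ j < 2 + m) k′≡0 (toℕ<n j)) (n≤1+n 2))))
                         (λ k′≢0 → ⊥-elim (k′≢0 k′≡0))
        where
        ¬B-at-end : ¬ T (isB (part (toℕ (walk (p j₀ + L)))))
        ¬B-at-end = subst (¬_ ∘ T ∘ isB)
          (sym (trans (cong (part ∘ toℕ) (walk-+L (p j₀))) (trans (cong part (walk-p j₀)) part-sVertex))) (λ ())
      ... | no k′≢0 with hub-between-b₀-and (p j₂) (<⇒≤ (mono j₁ j₂ (s<s z<s))) ¬B-at-p₂
                           (λ j 3≤j → mono j₂ j (subst (λ m → 2 + m < toℕ j) (sym (toℕ-fromℕ< k′>0)) 3≤j))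
                           (λ _ → p<p₀+L j₂)
        where
        k′>0 : 0 < k′
        k′>0 = n≢0⇒n>0 k′≢0
        j₂ : Fin (2 + k′)
        j₂ = Fin.suc (Fin.suc (fromℕ< k′>0))
        ¬B-at-p₂ : ¬ T (isB (part (toℕ (walk (p j₂)))))
        ¬B-at-p₂ = subst (¬_ ∘ T ∘ isB) (sym (trans (cong part (walk-p j₂)) (cong part (toℕ-fromℕ< k′>0)))) (λ ())
      ...   | r , p₁<r , r≤p₂ , w = r , p₁<r , ≤-trans r≤p₂ (<⇒≤ (p<p₀+L _)) , w

      hub-visited-twice : ⊥
      hub-visited-twice with hub-before-b₀ | hub-after-b₀
      ... | r₁ , p₀<r₁ , r₁≤p₁ , w₁ | r₂ , p₁<r₂ , r₂≤p₀+L , w₂ =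
        <⇒≢ (≤-<-trans r₁≤p₁ p₁<r₂)
            (walk-injective p₀<r₁ (s≤s (<⇒≤ (≤-<-trans r₁≤p₁ (p<p₀+L j₁))))
                            (<-trans p₀<p₁ p₁<r₂) (s≤s r₂≤p₀+L)
                            (toℕ-injective (trans w₁ (sym w₂))))

    not-ordered : ¬ KOrdered (2 + k′) (digraph n)
    not-ordered (_ , ordered) with ordered sequence sequence-injective
    ... | C , pos , hits , mono = hub-visited-twice C pos hits mono

not-ordered-digraph : ∀ k′ n → 2 + k′ < n →
                      Σ (Digraph n) λ D → MinDegreeIs D (⌈ n + (2 + k′) /2⌉ ∸ 2) × ¬ KOrdered (2 + k′) D
not-ordered-digraph k′ n k<n =
  digraph n , subst (MinDegreeIs (digraph n)) (sym δ≡b+k′) (minimum-degree 1≤b) , not-ordered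
  where
  r b a′ : ℕ
  r  = n ∸ (2 + k′)
  b  = ⌈ r /2⌉
  a′ = ⌊ r /2⌋
  open Construction k′ b
  n≡ : 2 + k′ + (b + a′) ≡ n
  n≡ = trans (cong (2 + k′ +_) (trans (+-comm b a′) (⌊n/2⌋+⌈n/2⌉≡n r))) (m+[n∸m]≡n (<⇒≤ k<n))
  1≤b : 1 ≤ b
  1≤b = ⌈n/2⌉-mono (m<n⇒0<n∸m k<n)
  b≤a′+1 : b ≤ suc a′
  b≤a′+1 = ⌈n/2⌉≤1+⌊n/2⌋ r
  sVertex<n : sVertex < n
  sVertex<n = subst (sVertex <_) n≡ (s≤s (s≤s (+-monoʳ-≤ k′ (m≤m+n b a′))))
  δ≡b+k′ : ⌈ n + (2 + k′) /2⌉ ∸ 2 ≡ b + k′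
  δ≡b+k′ = begin
    ⌈ n + (2 + k′) /2⌉ ∸ 2                ≡⟨ cong (λ m → ⌈ m + (2 + k′) /2⌉ ∸ 2) (m∸n+n≡m (<⇒≤ k<n)) ⟨
    ⌈ r + (2 + k′) + (2 + k′) /2⌉ ∸ 2     ≡⟨ cong (_∸ 2) (⌈m+n+n/2⌉≡⌈m/2⌉+n r (2 + k′)) ⟩
    b + (2 + k′) ∸ 2                      ≡⟨ cong (_∸ 2) (trans (+-suc b (suc k′)) (cong suc (+-suc b k′))) ⟩
    b + k′                                ∎
    where open ≡-Reasoning
  open Degrees n≡ b≤a′+1
  open NotOrdered 1≤b sVertex<n

proposition4 : (k n : ℕ) → 2 ≤ k → 2 * k ≤ n →
    Σ (Digraph n) λ D → MinDegreeIs D (⌈ n + k /2⌉ ∸ 2) × ¬ KOrdered k D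
proposition4 (suc zero)     n (s≤s ()) _
proposition4 (suc (suc k′)) n _        2k≤n = not-ordered-digraph k′ n (<-≤-trans (m<m+n (2 + k′) z<s) 2k≤n)
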